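{- Let $N$ be a set of positive integers. The class of $\ell$-bimonoidal subreducts of commutative involutive residuated lattices satisfying $x\leq x^{n}$ for all $n\in N$ is the variety of commutative $\ell$-bimonoids axiomatized by the inequalities $x\leq x^{n}$ and $nx\leq x$ for $n\in N$.
   Context: A commutative $\ell$-bimonoid $\langle A,\vee,\wedge,\cdot,1,+,0\rangle$ is a lattice with two commutative monoid operations $\cdot$ (unit $1$) and $+$ (unit $0$) such that $x\cdot(y\vee z)=(x\cdot y)\vee(x\cdot z)$, $x+(y\wedge z)=(x+y)\wedge(x+z)$ and $x\cdot(y+z)\leq(x\cdot y)+z$. Here $x^{n}$ is the $n$-fold product $x\cdot\ldots\cdot x$ and $nx$ the $n$-fold sum $x+\ldots+x$. A commutative involutive residuated lattice $\langle B,\vee,\wedge,\cdot,1,\rightarrow,0\rangle$ is a lattice with a commutative monoid operation $\cdot$, an operation $\rightarrow$ with $x\cdot y\leq z\iff y\leq x\rightarrow z$, and a constant $0$ with $(x\rightarrow 0)\rightarrow 0=x$; setting $\overline{x}=x\rightarrow 0$ and $x+y:=\overline{\overline{x}\cdot\overline{y}}$, its $\ell$-bimonoid reduct is $\langle B,\vee,\wedge,\cdot,1,+,0\rangle$. An $\ell$-bimonoidal subreduct of $\mathbf{B}$ is an $\ell$-bimonoid isomorphic to a subalgebra of this reduct. -}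

module Defs where

open import Level using (Level; _⊔_; suc)
open import Data.Nat using (ℕ; zero) renaming (suc to sucℕ)
open import Data.Product using (Σ; _×_)
open import Relation.Binary.Core using (Rel)
open import Relation.Unary using (Pred; _∈_)
open import Algebra.Core using (Op₂)
open import Algebra.Structures using (IsCommutativeMonoid)
open import Algebra.Lattice.Structures using (IsLattice)

record CommLBimonoid (c ℓ : Level) : Set (suc (c ⊔ ℓ)) where
  infixr 7 _·_
  infixr 6 _+_
  infixr 5 _∨_
  infixr 5 _∧_
  infix  4 _≈_ _≤_
  field
    Carrier : Set c
    _≈_     : Rel Carrier ℓ
    _∨_     : Op₂ Carrier
    _∧_     : Op₂ Carrier
    _·_     : Op₂ Carrier
    1#      : Carrier
    _+_     : Op₂ Carrier
    0#      : Carrier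
    isLattice         : IsLattice _≈_ _∨_ _∧_
    ·-isCommMonoid    : IsCommutativeMonoid _≈_ _·_ 1#
    +-isCommMonoid    : IsCommutativeMonoid _≈_ _+_ 0#

  _≤_ : Rel Carrier ℓ
  x ≤ y = (x ∧ y) ≈ x

  field
    ·-distrib-∨ : ∀ x y z → (x · (y ∨ z)) ≈ ((x · y) ∨ (x · z))
    +-distrib-∧ : ∀ x y z → (x + (y ∧ z)) ≈ ((x + y) ∧ (x + z))
    linear-distrib : ∀ x y z → (x · (y + z)) ≤ ((x · y) + z)

  _^_ : Carrier → ℕ → Carrier
  x ^ zero     = 1#
  x ^ (sucℕ n) = x · (x ^ n)

  _×̇_ : ℕ → Carrier → Carrier
  zero ×̇ x     = 0#
  (sucℕ n) ×̇ x = x + (n ×̇ x)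

record CIRL (c ℓ : Level) : Set (suc (c ⊔ ℓ)) where
  infixr 7 _·_
  infixr 5 _∨_
  infixr 5 _∧_
  infixr 4 _⇒_
  infix  4 _≈_ _≤_
  field
    Carrier : Set c
    _≈_     : Rel Carrier ℓ
    _∨_     : Op₂ Carrier
    _∧_     : Op₂ Carrier
    _·_     : Op₂ Carrier
    1#      : Carrier
    _⇒_     : Op₂ Carrier
    0#      : Carrier
    isLattice      : IsLattice _≈_ _∨_ _∧_
    ·-isCommMonoid : IsCommutativeMonoid _≈_ _·_ 1#
    ⇒-cong         : ∀ {x y u v} → x ≈ y → u ≈ v → (x ⇒ u) ≈ (y ⇒ v)

  _≤_ : Rel Carrier ℓ
  x ≤ y = (x ∧ y) ≈ x

  field
    residuated-to   : ∀ x y z → (x · y) ≤ z → y ≤ (x ⇒ z)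
    residuated-from : ∀ x y z → y ≤ (x ⇒ z) → (x · y) ≤ z
    involutive      : ∀ x → ((x ⇒ 0#) ⇒ 0#) ≈ x

  ~_ : Carrier → Carrier
  ~ x = x ⇒ 0#

  _+_ : Op₂ Carrier
  x + y = ~ ((~ x) · (~ y))

  _^_ : Carrier → ℕ → Carrier
  x ^ zero     = 1#
  x ^ (sucℕ n) = x · (x ^ n)

CIRL-Sat : ∀ {c ℓ} → Pred ℕ Level.zero → CIRL c ℓ → Set (c ⊔ ℓ)
CIRL-Sat N B = ∀ n → n ∈ N → ∀ x → x ≤ (x ^ n)
  where open CIRL B

Bimonoid-Sat : ∀ {c ℓ} → Pred ℕ Level.zero → CommLBimonoid c ℓ → Set (c ⊔ ℓ)
Bimonoid-Sat N A = ∀ n → n ∈ N → ∀ x → (x ≤ (x ^ n)) × ((n ×̇ x) ≤ x)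
  where open CommLBimonoid A

-- Embeddings of an ℓ-bimonoid into the ℓ-bimonoid reduct
-- ⟨B, ∨, ∧, ·, 1, +, 0⟩ of a CIRL B (i.e. isomorphisms onto a subalgebra
-- of the reduct): injective homomorphisms.

record Embedding {c₁ ℓ₁ c₂ ℓ₂} (A : CommLBimonoid c₁ ℓ₁) (B : CIRL c₂ ℓ₂)
       : Set (c₁ ⊔ ℓ₁ ⊔ c₂ ⊔ ℓ₂) where
  private
    module A = CommLBimonoid A
    module B = CIRL B
  field
    f      : A.Carrier → B.Carrier
    f-cong : ∀ {x y} → x A.≈ y → f x B.≈ f y
    f-inj  : ∀ {x y} → f x B.≈ f y → x A.≈ y
    f-∨    : ∀ x y → f (x A.∨ y) B.≈ (f x B.∨ f y)
    f-∧    : ∀ x y → f (x A.∧ y) B.≈ (f x B.∧ f y)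
    f-·    : ∀ x y → f (x A.· y) B.≈ (f x B.· f y)
    f-1    : f A.1# B.≈ B.1#
    f-+    : ∀ x y → f (x A.+ y) B.≈ (f x B.+ f y)
    f-0    : f A.0# B.≈ B.0#

IsSubreduct : ∀ {c ℓ} (c₂ ℓ₂ : Level) → Pred ℕ Level.zero → CommLBimonoid c ℓ
            → Set (c ⊔ ℓ ⊔ suc (c₂ ⊔ ℓ₂))
IsSubreduct c₂ ℓ₂ N A = Σ (CIRL c₂ ℓ₂) (λ B → CIRL-Sat N B × Embedding A B)

{-# OPTIONS --safe #-}
-- Soundness: an embedding f of A into an involutive residuated lattice reflects the order
-- and sends x ^ n to (f x) ^ n and n x to ~ ((~ f x) ^ n); so x ≤ x ^ n, applied in the
-- lattice to f x and to ~ f x, gives x ≤ x ^ n and n x ≤ x in A.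
--
-- Completeness is a phase-space construction.  The product monoid (A, ·, 1) × (A, +, 0)
-- with pole {(g , d) | g ≤ d} has as facts (sets equal to their double orthogonal) an
-- involutive residuated lattice.  Send a to ι a = {(1 , a)}^⊥ = {(g , d) | g ≤ d + a},
-- which is also the fact generated by (a , 0); the linear distributivity
-- x (y + z) ≤ x y + z is what makes ι preserve · and +.  Finally, if x ≤ x ^ n and
-- n x ≤ x in A, then every point p = (g , d), whose n-th power is pⁿ = (g ^ n , n d),
-- satisfies {pⁿ}^⊥ ⊆ {p}^⊥, and hence every fact X satisfies X ≤ X ^ n.

module Submission where

open import Defs
open import Level using (Level; _⊔_; suc)
open import Data.Nat using (ℕ; _≤_; zero) renaming (suc to sucℕ)
open import Data.Product using (_×_; _,_; proj₁; proj₂; ∃₂)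
open import Data.Sum using (inj₁; inj₂; [_,_])
open import Relation.Unary using (Pred; _∈_; _⊆_; _∪_; _∩_; ｛_｝)
open import Relation.Binary.Core using (Rel)
open import Relation.Binary.Definitions using (_Respects_)
open import Relation.Binary.Structures using (IsEquivalence; IsPartialOrder)
open import Relation.Binary.PropositionalEquality using (_≡_; refl; cong; subst)
open import Algebra.Bundles using (CommutativeMonoid)
open import Algebra.Lattice.Bundles using (Lattice)
import Algebra.Lattice.Properties.Lattice as LatticeProperties
import Algebra.Properties.CommutativeSemigroup as CommutativeSemigroupProperties
import Algebra.Construct.DirectProduct as DirectProduct
import Algebra.Definitions.RawMonoid as RawMonoidDefinitions
import Relation.Binary.Lattice as OrderLattice
import Relation.Binary.Lattice.Properties.Lattice as OrderLatticeProperties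
import Relation.Binary.Lattice.Properties.JoinSemilattice as JoinSemilatticeProperties
import Relation.Binary.Reasoning.PartialOrder as ≤-Reasoning

module LBimonoidOrder {c ℓ} (A : CommLBimonoid c ℓ) where
  open CommLBimonoid A public hiding (_≤_)

  lattice : Lattice c ℓ
  lattice = record { isLattice = isLattice }

  ·-commutativeMonoid : CommutativeMonoid c ℓ
  ·-commutativeMonoid = record { isCommutativeMonoid = ·-isCommMonoid }

  +-commutativeMonoid : CommutativeMonoid c ℓ
  +-commutativeMonoid = record { isCommutativeMonoid = +-isCommMonoid }

  open Lattice lattice public using (∨-cong)
    renaming (refl to ≈-refl; sym to ≈-sym; trans to ≈-trans)
  open CommutativeMonoid ·-commutativeMonoid public using ()
    renaming (comm to ·-comm; identityˡ to ·-identityˡ; identityʳ to ·-identityʳ;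
              ∙-congˡ to ·-congˡ)
  open CommutativeMonoid +-commutativeMonoid public using ()
    renaming (comm to +-comm; identityˡ to +-identityˡ; identityʳ to +-identityʳ;
              ∙-cong to +-cong; ∙-congˡ to +-congˡ; ∙-congʳ to +-congʳ)
  open CommutativeSemigroupProperties (CommutativeMonoid.commutativeSemigroup +-commutativeMonoid)
    using () renaming (xy∙z≈yz∙x to [x+y]+z≈[y+z]+x)
  open CommutativeSemigroupProperties (CommutativeMonoid.commutativeSemigroup ·-commutativeMonoid)
    using () renaming (xy∙z≈y∙xz to [x·y]·z≈y·[x·z])

  orderLattice : OrderLattice.Lattice c ℓ ℓ
  orderLattice = LatticeProperties.∨-∧-orderTheoreticLattice lattice

  open OrderLattice.Lattice orderLattice public
    using (poset; x≤x∨y; y≤x∨y; ∨-least; x∧y≤x; x∧y≤y; ∧-greatest)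
    renaming (_≤_ to _⊑_; reflexive to ≈⇒⊑; trans to ⊑-trans; antisym to ⊑-antisym)
  open JoinSemilatticeProperties (OrderLattice.Lattice.joinSemilattice orderLattice)
    using (x≤y⇒x∨y≈y)
  open ≤-Reasoning poset

  -- The lattice order is x ≈ x ∧ y, the mirror image of CommLBimonoid._≤_.
  ≤⇒⊑ : ∀ {x y} → CommLBimonoid._≤_ A x y → x ⊑ y
  ≤⇒⊑ = ≈-sym

  ·-monoʳ : ∀ x {y z} → y ⊑ z → x · y ⊑ x · z
  ·-monoʳ x {y} {z} y⊑z = begin
    x · y          ≤⟨ x≤x∨y (x · y) (x · z) ⟩
    x · y ∨ x · z  ≈⟨ ·-distrib-∨ x y z ⟨
    x · (y ∨ z)    ≈⟨ ·-congˡ (x≤y⇒x∨y≈y y⊑z) ⟩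
    x · z          ∎

  ·-monoˡ : ∀ x {y z} → y ⊑ z → y · x ⊑ z · x
  ·-monoˡ x {y} {z} y⊑z = begin
    y · x  ≈⟨ ·-comm y x ⟩
    x · y  ≤⟨ ·-monoʳ x y⊑z ⟩
    x · z  ≈⟨ ·-comm x z ⟩
    z · x  ∎

  ·-mono : ∀ {x x′ y y′} → x ⊑ x′ → y ⊑ y′ → x · y ⊑ x′ · y′
  ·-mono {x′ = x′} {y = y} x⊑x′ y⊑y′ = ⊑-trans (·-monoˡ y x⊑x′) (·-monoʳ x′ y⊑y′)

  +-monoʳ : ∀ x {y z} → y ⊑ z → x + y ⊑ x + z
  +-monoʳ x {y} {z} y⊑z = begin
    x + y              ≈⟨ +-congˡ y⊑z ⟩
    x + (y ∧ z)        ≈⟨ +-distrib-∧ x y z ⟩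
    (x + y) ∧ (x + z)  ≤⟨ x∧y≤y (x + y) (x + z) ⟩
    x + z              ∎

  +-monoˡ : ∀ x {y z} → y ⊑ z → y + x ⊑ z + x
  +-monoˡ x {y} {z} y⊑z = begin
    y + x  ≈⟨ +-comm y x ⟩
    x + y  ≤⟨ +-monoʳ x y⊑z ⟩
    x + z  ≈⟨ +-comm x z ⟩
    z + x  ∎

  linear-distrib-⊑ : ∀ x y z → x · (y + z) ⊑ x · y + z
  linear-distrib-⊑ x y z = ≤⇒⊑ (linear-distrib x y z)

  ·-distribʳ-∨ : ∀ x y z → (y ∨ z) · x ≈ y · x ∨ z · x
  ·-distribʳ-∨ x y z = begin-equality
    (y ∨ z) · x    ≈⟨ ·-comm (y ∨ z) x ⟩
    x · (y ∨ z)    ≈⟨ ·-distrib-∨ x y z ⟩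
    x · y ∨ x · z  ≈⟨ ∨-cong (·-comm x y) (·-comm x z) ⟩
    y · x ∨ z · x  ∎

  cut : ∀ {x y z v w} → x · y ⊑ z → w ⊑ v + x → w · y ⊑ v + z
  cut {x} {y} {z} {v} {w} xy⊑z w⊑v+x = begin
    w · y        ≤⟨ ·-monoˡ y w⊑v+x ⟩
    (v + x) · y  ≈⟨ ≈-trans (·-comm (v + x) y) (·-congˡ (+-comm v x)) ⟩
    y · (x + v)  ≤⟨ linear-distrib-⊑ y x v ⟩
    y · x + v    ≈⟨ +-congʳ (·-comm y x) ⟩
    x · y + v    ≤⟨ +-monoˡ v xy⊑z ⟩
    z + v        ≈⟨ +-comm z v ⟩
    v + z        ∎

  [x+y]·[z+w]⊑[x+z]+y·w : ∀ x y z w → (x + y) · (z + w) ⊑ (x + z) + y · w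
  [x+y]·[z+w]⊑[x+z]+y·w x y z w = begin
    (x + y) · (z + w)  ≈⟨ ·-congˡ (+-comm z w) ⟩
    (x + y) · (w + z)  ≤⟨ linear-distrib-⊑ (x + y) w z ⟩
    (x + y) · w + z    ≈⟨ +-congʳ (≈-trans (·-comm (x + y) w) (·-congˡ (+-comm x y))) ⟩
    w · (y + x) + z    ≤⟨ +-monoˡ z (linear-distrib-⊑ w y x) ⟩
    (w · y + x) + z    ≈⟨ [x+y]+z≈[y+z]+x (w · y) x z ⟩
    (x + z) + w · y    ≈⟨ +-congˡ (·-comm w y) ⟩
    (x + z) + y · w    ∎

  [x+y]·[z·w]⊑x·z+y·w : ∀ x y z w → (x + y) · (z · w) ⊑ x · z + y · w
  [x+y]·[z·w]⊑x·z+y·w x y z w = begin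
    (x + y) · (z · w)  ≈⟨ ·-comm (x + y) (z · w) ⟩
    (z · w) · (x + y)  ≈⟨ [x·y]·z≈y·[x·z] z w (x + y) ⟩
    w · (z · (x + y))  ≤⟨ ·-monoʳ w (linear-distrib-⊑ z x y) ⟩
    w · (z · x + y)    ≈⟨ ·-congˡ (+-comm (z · x) y) ⟩
    w · (y + z · x)    ≤⟨ linear-distrib-⊑ w y (z · x) ⟩
    w · y + z · x      ≈⟨ +-comm (w · y) (z · x) ⟩
    z · x + w · y      ≈⟨ +-cong (·-comm z x) (·-comm w y) ⟩
    x · z + y · w      ∎

module CIRLOrder {c ℓ} (B : CIRL c ℓ) where
  open CIRL B public hiding (_≤_)

  lattice : Lattice c ℓ
  lattice = record { isLattice = isLattice }

  ·-commutativeMonoid : CommutativeMonoid c ℓ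
  ·-commutativeMonoid = record { isCommutativeMonoid = ·-isCommMonoid }

  open Lattice lattice public using ()
    renaming (refl to ≈-refl; sym to ≈-sym; trans to ≈-trans)
  open CommutativeMonoid ·-commutativeMonoid public using ()
    renaming (comm to ·-comm; identityˡ to ·-identityˡ; ∙-congˡ to ·-congˡ)
  open OrderLattice.Lattice (LatticeProperties.∨-∧-orderTheoreticLattice lattice) public
    using (poset)
    renaming (_≤_ to _⊑_; refl to ⊑-refl; reflexive to ≈⇒⊑; trans to ⊑-trans; antisym to ⊑-antisym)
  open ≤-Reasoning poset

  ≤⇒⊑ : ∀ {x y} → CIRL._≤_ B x y → x ⊑ y
  ≤⇒⊑ = ≈-sym

  ·-⇒-residuated : ∀ {x y z} → x · y ⊑ z → y ⊑ (x ⇒ z)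
  ·-⇒-residuated {x} {y} {z} x·y⊑z = ≤⇒⊑ (residuated-to x y z (≈-sym x·y⊑z))

  ⇒-·-residuated : ∀ {x y z} → y ⊑ (x ⇒ z) → x · y ⊑ z
  ⇒-·-residuated {x} {y} {z} y⊑x⇒z = ≤⇒⊑ (residuated-from x y z (≈-sym y⊑x⇒z))

  ·-monoʳ : ∀ x {y z} → y ⊑ z → x · y ⊑ x · z
  ·-monoʳ x y⊑z = ⇒-·-residuated (⊑-trans y⊑z (·-⇒-residuated ⊑-refl))

  x·~x⊑0 : ∀ x → x · (~ x) ⊑ 0#
  x·~x⊑0 x = ⇒-·-residuated ⊑-refl

  ~-antitone : ∀ {x y} → x ⊑ y → ~ y ⊑ ~ x
  ~-antitone {x} {y} x⊑y = ·-⇒-residuated (begin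
    x · (~ y)  ≈⟨ ·-comm x (~ y) ⟩
    (~ y) · x  ≤⟨ ·-monoʳ (~ y) x⊑y ⟩
    (~ y) · y  ≈⟨ ·-comm (~ y) y ⟩
    y · (~ y)  ≤⟨ x·~x⊑0 y ⟩
    0#         ∎)

  ~-cong : ∀ {x y} → x ≈ y → ~ x ≈ ~ y
  ~-cong x≈y = ⇒-cong x≈y ≈-refl

  ~1≈0 : ~ 1# ≈ 0#
  ~1≈0 = ⊑-antisym (⊑-trans (≈⇒⊑ (≈-sym (·-identityˡ (~ 1#)))) (x·~x⊑0 1#))
                   (·-⇒-residuated (≈⇒⊑ (·-identityˡ 0#)))

module EmbeddingReflects {c ℓ c₂ ℓ₂} {A : CommLBimonoid c ℓ} {B : CIRL c₂ ℓ₂}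
                         (E : Embedding A B) where
  module A = CommLBimonoid A
  open CIRLOrder B
  open Embedding E
  open ≤-Reasoning poset

  f-^ : ∀ x n → f (x A.^ n) ≈ f x ^ n
  f-^ x zero     = f-1
  f-^ x (sucℕ n) = ≈-trans (f-· x (x A.^ n)) (·-congˡ (f-^ x n))

  f-×̇ : ∀ x n → f (n A.×̇ x) ≈ ~ ((~ f x) ^ n)
  f-×̇ x zero     = ≈-trans f-0 (≈-sym ~1≈0)
  f-×̇ x (sucℕ n) = begin-equality
    f (x A.+ n A.×̇ x)               ≈⟨ f-+ x (n A.×̇ x) ⟩
    ~ ((~ f x) · ~ f (n A.×̇ x))      ≈⟨ ~-cong (·-congˡ (~-cong (f-×̇ x n))) ⟩
    ~ ((~ f x) · ~ ~ ((~ f x) ^ n))  ≈⟨ ~-cong (·-congˡ (involutive ((~ f x) ^ n))) ⟩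
    ~ ((~ f x) · (~ f x) ^ n)        ∎

  f-reflects-≤ : ∀ {x y} → f x ⊑ f y → x A.≤ y
  f-reflects-≤ {x} {y} fx⊑fy = f-inj (≈-trans (f-∧ x y) (≈-sym fx⊑fy))

  Bimonoid-Sat-reflected : ∀ N → CIRL-Sat N B → Bimonoid-Sat N A
  Bimonoid-Sat-reflected N B-sat n n∈N x = f-reflects-≤ x⊑xⁿ , f-reflects-≤ nx⊑x
    where
    x⊑xⁿ : f x ⊑ f (x A.^ n)
    x⊑xⁿ = begin
      f x          ≤⟨ ≤⇒⊑ (B-sat n n∈N (f x)) ⟩
      f x ^ n      ≈⟨ f-^ x n ⟨
      f (x A.^ n)  ∎
    nx⊑x : f (n A.×̇ x) ⊑ f x
    nx⊑x = begin
      f (n A.×̇ x)       ≈⟨ f-×̇ x n ⟩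
      ~ ((~ f x) ^ n)   ≤⟨ ~-antitone (≤⇒⊑ (B-sat n n∈N (~ f x))) ⟩
      ~ ~ f x           ≈⟨ involutive (f x) ⟩
      f x               ∎

module PhaseSpace {m ℓm p} (M : CommutativeMonoid m ℓm)
                  (⊥ : Pred (CommutativeMonoid.Carrier M) p)
                  (⊥-resp-≈ : ⊥ Respects CommutativeMonoid._≈_ M) where
  open CommutativeMonoid M hiding (refl)
  open CommutativeSemigroupProperties commutativeSemigroup using (xy∙z≈y∙zx)
  open RawMonoidDefinitions rawMonoid public using () renaming (_×_ to _×ᴹ_)

  L : Level
  L = m ⊔ p

  infix 9 _^⊥
  _^⊥ : ∀ {q} → Pred Carrier q → Pred Carrier (m ⊔ p ⊔ q)
  (P ^⊥) y = ∀ {x} → x ∈ P → ⊥ (y ∙ x)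

  ^⊥-antitone : ∀ {q r} {P : Pred Carrier q} {Q : Pred Carrier r} → P ⊆ Q → Q ^⊥ ⊆ P ^⊥
  ^⊥-antitone P⊆Q y∈Q^⊥ x∈P = y∈Q^⊥ (P⊆Q x∈P)

  ⊆-^⊥^⊥ : ∀ {q} {P : Pred Carrier q} → P ⊆ P ^⊥ ^⊥
  ⊆-^⊥^⊥ {x = y} y∈P {x} x∈P^⊥ = ⊥-resp-≈ (comm x y) (x∈P^⊥ y∈P)

  ^⊥^⊥^⊥⊆^⊥ : ∀ {q} {P : Pred Carrier q} → P ^⊥ ^⊥ ^⊥ ⊆ P ^⊥
  ^⊥^⊥^⊥⊆^⊥ = ^⊥-antitone ⊆-^⊥^⊥

  record Fact : Set (suc L) where
    field
      ⟦_⟧    : Pred Carrier L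
      closed : ⟦_⟧ ^⊥ ^⊥ ⊆ ⟦_⟧
  open Fact public

  closure-least : ∀ {q} {P : Pred Carrier q} (Z : Fact) → P ⊆ ⟦ Z ⟧ → P ^⊥ ^⊥ ⊆ ⟦ Z ⟧
  closure-least Z P⊆Z x∈ = closed Z (^⊥-antitone (^⊥-antitone P⊆Z) x∈)

  ∈-resp-≈ : (Z : Fact) → ⟦ Z ⟧ Respects _≈_
  ∈-resp-≈ Z {x} {y} x≈y x∈Z = closed Z λ {w} w∈Z^⊥ →
    ⊥-resp-≈ (trans (comm w x) (∙-congʳ x≈y)) (w∈Z^⊥ x∈Z)

  closure : Pred Carrier L → Fact
  closure P = record { ⟦_⟧ = P ^⊥ ^⊥ ; closed = ^⊥^⊥^⊥⊆^⊥ }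

  _/_ : Fact → Carrier → Fact
  Z / x = record
    { ⟦_⟧    = λ y → y ∙ x ∈ ⟦ Z ⟧
    ; closed = λ y∈ → closed Z λ w∈Z^⊥ → ⊥-resp-≈ (sym (assoc _ _ _))
        (y∈ λ u∙x∈Z → ⊥-resp-≈ (sym (xy∙z≈y∙zx _ _ _)) (w∈Z^⊥ u∙x∈Z))
    }

  infix 4 _≼_ _≃_
  _≼_ : Rel Fact L
  X ≼ Y = ⟦ X ⟧ ⊆ ⟦ Y ⟧

  record _≃_ (X Y : Fact) : Set (suc L) where
    constructor ≼-antisym
    field
      to   : X ≼ Y
      from : Y ≼ X
  open _≃_ public

  ≃-isEquivalence : IsEquivalence _≃_
  ≃-isEquivalence = record
    { refl  = ≼-antisym (λ x∈ → x∈) (λ x∈ → x∈)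
    ; sym   = λ X≃Y → ≼-antisym (from X≃Y) (to X≃Y)
    ; trans = λ X≃Y Y≃Z → ≼-antisym (λ x∈ → to Y≃Z (to X≃Y x∈)) (λ x∈ → from X≃Y (from Y≃Z x∈))
    }

  ≼-isPartialOrder : IsPartialOrder _≃_ _≼_
  ≼-isPartialOrder = record
    { isPreorder = record
      { isEquivalence = ≃-isEquivalence
      ; reflexive     = to
      ; trans         = λ X≼Y Y≼Z x∈ → Y≼Z (X≼Y x∈)
      }
    ; antisym = ≼-antisym
    }

  infixr 6 _⊕_ _&_
  _⊕_ : Fact → Fact → Fact
  X ⊕ Y = closure (⟦ X ⟧ ∪ ⟦ Y ⟧)

  _&_ : Fact → Fact → Fact
  X & Y = record
    { ⟦_⟧    = ⟦ X ⟧ ∩ ⟦ Y ⟧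
    ; closed = λ x∈ → closure-least X proj₁ x∈ , closure-least Y proj₂ x∈
    }

  factLattice : OrderLattice.Lattice (suc L) (suc L) L
  factLattice = record
    { _≈_       = _≃_
    ; _≤_       = _≼_
    ; _∨_       = _⊕_
    ; _∧_       = _&_
    ; isLattice = record
      { isPartialOrder = ≼-isPartialOrder
      ; supremum       = λ X Y → (λ x∈ → ⊆-^⊥^⊥ (inj₁ x∈)) , (λ y∈ → ⊆-^⊥^⊥ (inj₂ y∈))
                                , λ Z X≼Z Y≼Z → closure-least Z [ X≼Z , Y≼Z ]
      ; infimum        = λ X Y → proj₁ , proj₂ , λ Z Z≼X Z≼Y z∈ → Z≼X z∈ , Z≼Y z∈
      }
    }

  x≼y⇒x&y≃x : ∀ {X Y} → X ≼ Y → X & Y ≃ X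
  x≼y⇒x&y≃x X≼Y = ≼-antisym proj₁ (λ x∈ → x∈ , X≼Y x∈)

  x&y≃x⇒x≼y : ∀ {X Y} → X & Y ≃ X → X ≼ Y
  x&y≃x⇒x≼y X&Y≃X x∈ = proj₂ (from X&Y≃X x∈)

  infixr 7 _⊗_
  _⊙_ : Pred Carrier L → Pred Carrier L → Pred Carrier L
  (P ⊙ Q) z = ∃₂ λ x y → x ∈ P × y ∈ Q × z ≡ x ∙ y

  _⊗_ : Fact → Fact → Fact
  X ⊗ Y = closure (⟦ X ⟧ ⊙ ⟦ Y ⟧)

  𝟏 : Fact
  𝟏 = record { ⟦_⟧ = ｛ ε ｝ ^⊥ ^⊥ ; closed = ^⊥^⊥^⊥⊆^⊥ }

  ∙-∈-⊗ : ∀ {X Y x y} → x ∈ ⟦ X ⟧ → y ∈ ⟦ Y ⟧ → x ∙ y ∈ ⟦ X ⊗ Y ⟧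
  ∙-∈-⊗ x∈X y∈Y = ⊆-^⊥^⊥ (_ , _ , x∈X , y∈Y , refl)

  ⊗-least : ∀ {X Y} (Z : Fact) → (∀ {x y} → x ∈ ⟦ X ⟧ → y ∈ ⟦ Y ⟧ → x ∙ y ∈ ⟦ Z ⟧) → X ⊗ Y ≼ Z
  ⊗-least Z h = closure-least Z λ { {_} (_ , _ , x∈X , y∈Y , refl) → h x∈X y∈Y }

  ∙-closureˡ : ∀ {q r} {P : Pred Carrier q} {Q : Pred Carrier r} (Z : Fact)
             → (∀ {x y} → x ∈ P → y ∈ Q → x ∙ y ∈ ⟦ Z ⟧)
             → ∀ {x y} → x ∈ P ^⊥ ^⊥ → y ∈ Q → x ∙ y ∈ ⟦ Z ⟧
  ∙-closureˡ Z h {y = y} x∈ y∈Q = closure-least (Z / y) (λ x∈P → h x∈P y∈Q) x∈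

  ⊗-mono : ∀ {X X′ Y Y′} → X ≼ X′ → Y ≼ Y′ → X ⊗ Y ≼ X′ ⊗ Y′
  ⊗-mono {X} {X′} {Y} {Y′} X≼X′ Y≼Y′ =
    ⊗-least {X} {Y} (X′ ⊗ Y′) λ x∈ y∈ → ∙-∈-⊗ {X′} {Y′} (X≼X′ x∈) (Y≼Y′ y∈)

  ⊗-comm-≼ : ∀ X Y → X ⊗ Y ≼ Y ⊗ X
  ⊗-comm-≼ X Y = ⊗-least {X} {Y} (Y ⊗ X) λ x∈X y∈Y →
    ∈-resp-≈ (Y ⊗ X) (comm _ _) (∙-∈-⊗ {Y} {X} y∈Y x∈X)

  ⊗-assoc-≼ : ∀ X Y Z → (X ⊗ Y) ⊗ Z ≼ X ⊗ (Y ⊗ Z)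
  ⊗-assoc-≼ X Y Z = ⊗-least {X ⊗ Y} {Z} T (∙-closureˡ T λ { {_} (x , y , x∈X , y∈Y , refl) z∈Z →
      ∈-resp-≈ T (sym (assoc x y _)) (∙-∈-⊗ {X} {Y ⊗ Z} x∈X (∙-∈-⊗ {Y} {Z} y∈Y z∈Z)) })
    where T = X ⊗ (Y ⊗ Z)

  ⊗-assoc-≽ : ∀ X Y Z → X ⊗ (Y ⊗ Z) ≼ (X ⊗ Y) ⊗ Z
  ⊗-assoc-≽ X Y Z = begin
    X ⊗ (Y ⊗ Z)  ≤⟨ ⊗-comm-≼ X (Y ⊗ Z) ⟩
    (Y ⊗ Z) ⊗ X  ≤⟨ ⊗-assoc-≼ Y Z X ⟩
    Y ⊗ (Z ⊗ X)  ≤⟨ ⊗-comm-≼ Y (Z ⊗ X) ⟩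
    (Z ⊗ X) ⊗ Y  ≤⟨ ⊗-assoc-≼ Z X Y ⟩
    Z ⊗ (X ⊗ Y)  ≤⟨ ⊗-comm-≼ Z (X ⊗ Y) ⟩
    (X ⊗ Y) ⊗ Z  ∎
    where open ≤-Reasoning (OrderLattice.Lattice.poset factLattice)

  ⊗-identityˡ : ∀ X → 𝟏 ⊗ X ≃ X
  ⊗-identityˡ X = ≼-antisym
    (⊗-least {𝟏} {X} X (∙-closureˡ X λ { {_} refl x∈X → ∈-resp-≈ X (sym (identityˡ _)) x∈X }))
    (λ {x} x∈X → ∈-resp-≈ (𝟏 ⊗ X) (identityˡ x) (∙-∈-⊗ {𝟏} {X} (⊆-^⊥^⊥ refl) x∈X))

  𝟎 : Fact
  𝟎 = record { ⟦_⟧ = ｛ ε ｝ ^⊥ ; closed = ^⊥^⊥^⊥⊆^⊥ }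

  ⊥⇒∈𝟎 : ∀ {y} → ⊥ y → y ∈ ⟦ 𝟎 ⟧
  ⊥⇒∈𝟎 ⊥y refl = ⊥-resp-≈ (sym (identityʳ _)) ⊥y

  ∈𝟎⇒⊥ : ∀ {y} → y ∈ ⟦ 𝟎 ⟧ → ⊥ y
  ∈𝟎⇒⊥ y∈𝟎 = ⊥-resp-≈ (identityʳ _) (y∈𝟎 refl)

  infixr 5 _⊸_
  _⊸_ : Fact → Fact → Fact
  X ⊸ Z = record
    { ⟦_⟧    = λ y → ∀ {x} → x ∈ ⟦ X ⟧ → y ∙ x ∈ ⟦ Z ⟧
    ; closed = λ y∈ {x} x∈X → closure-least (Z / x) (λ y∈X⊸Z → y∈X⊸Z x∈X) y∈
    }

  ⊸-mono : ∀ {X X′ Z Z′} → X′ ≼ X → Z ≼ Z′ → X ⊸ Z ≼ X′ ⊸ Z′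
  ⊸-mono X′≼X Z≼Z′ y∈ x∈X′ = Z≼Z′ (y∈ (X′≼X x∈X′))

  ⊗-⊸-residuated : ∀ X Y Z → X ⊗ Y ≼ Z → Y ≼ X ⊸ Z
  ⊗-⊸-residuated X Y Z X⊗Y≼Z y∈Y x∈X =
    X⊗Y≼Z (∈-resp-≈ (X ⊗ Y) (comm _ _) (∙-∈-⊗ {X} {Y} x∈X y∈Y))

  ⊸-⊗-residuated : ∀ X Y Z → Y ≼ X ⊸ Z → X ⊗ Y ≼ Z
  ⊸-⊗-residuated X Y Z Y≼X⊸Z =
    ⊗-least {X} {Y} Z λ x∈X y∈Y → ∈-resp-≈ Z (comm _ _) (Y≼X⊸Z y∈Y x∈X)

  ~_ : Fact → Fact
  ~ X = X ⊸ 𝟎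

  ~-⊆-^⊥ : ∀ X → ⟦ ~ X ⟧ ⊆ ⟦ X ⟧ ^⊥
  ~-⊆-^⊥ X y∈ x∈X = ∈𝟎⇒⊥ (y∈ x∈X)

  ^⊥-⊆-~ : ∀ X → ⟦ X ⟧ ^⊥ ⊆ ⟦ ~ X ⟧
  ^⊥-⊆-~ X y∈ x∈X = ⊥⇒∈𝟎 (y∈ x∈X)

  ~-involutive : ∀ X → ~ ~ X ≃ X
  ~-involutive X = ≼-antisym
    (λ y∈ → closed X (^⊥-antitone (^⊥-⊆-~ X) (~-⊆-^⊥ (~ X) y∈)))
    (λ y∈ → ^⊥-⊆-~ (~ X) (^⊥-antitone (~-⊆-^⊥ X) (⊆-^⊥^⊥ y∈)))

  phaseAlgebra : CIRL (suc L) (suc L)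
  phaseAlgebra = record
    { Carrier         = Fact
    ; _≈_             = _≃_
    ; _∨_             = _⊕_
    ; _∧_             = _&_
    ; _·_             = _⊗_
    ; 1#              = 𝟏
    ; _⇒_             = _⊸_
    ; 0#              = 𝟎
    ; isLattice       = OrderLatticeProperties.isAlgLattice factLattice
    ; ·-isCommMonoid  = isCommutativeMonoidˡ record
      { isSemigroup = record
        { isMagma = record
          { isEquivalence = ≃-isEquivalence
          ; ∙-cong        = λ {X} {X′} {Y} {Y′} X≃X′ Y≃Y′ →
              ≼-antisym (⊗-mono {X} {X′} {Y} {Y′} (to X≃X′) (to Y≃Y′))
                        (⊗-mono {X′} {X} {Y′} {Y} (from X≃X′) (from Y≃Y′))
          }
        ; assoc   = λ X Y Z → ≼-antisym (⊗-assoc-≼ X Y Z) (⊗-assoc-≽ X Y Z)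
        }
      ; identityˡ = ⊗-identityˡ
      ; comm      = λ X Y → ≼-antisym (⊗-comm-≼ X Y) (⊗-comm-≼ Y X)
      }
    ; ⇒-cong          = λ {X} {X′} {Z} {Z′} X≃X′ Z≃Z′ →
        ≼-antisym (⊸-mono {X} {X′} {Z} {Z′} (from X≃X′) (to Z≃Z′))
                  (⊸-mono {X′} {X} {Z′} {Z} (to X≃X′) (from Z≃Z′))
    ; residuated-to   = λ X Y Z X⊗Y≤Z →
        x≼y⇒x&y≃x {Y} {X ⊸ Z} (⊗-⊸-residuated X Y Z (x&y≃x⇒x≼y {X ⊗ Y} {Z} X⊗Y≤Z))
    ; residuated-from = λ X Y Z Y≤X⊸Z →
        x≼y⇒x&y≃x {X ⊗ Y} {Z} (⊸-⊗-residuated X Y Z (x&y≃x⇒x≼y {Y} {X ⊸ Z} Y≤X⊸Z))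
    ; involutive      = ~-involutive
    }
    where open import Algebra.Structures.Biased _≃_ using (isCommutativeMonoidˡ)

  open CIRL phaseAlgebra using (_^_)

  ×ᴹ-∈-^ : ∀ {X x} n → x ∈ ⟦ X ⟧ → n ×ᴹ x ∈ ⟦ X ^ n ⟧
  ×ᴹ-∈-^ zero     _   = ⊆-^⊥^⊥ refl
  ×ᴹ-∈-^ {X} (sucℕ n) x∈X = ∙-∈-⊗ {X} {X ^ n} x∈X (×ᴹ-∈-^ n x∈X)

  ≼-^ : ∀ n → (∀ {x y} → ⊥ (y ∙ (n ×ᴹ x)) → ⊥ (y ∙ x)) → ∀ X → X ≼ X ^ n
  ≼-^ n shrink X x∈X = closed (X ^ n) λ y∈ → ⊥-resp-≈ (comm _ _) (shrink (y∈ (×ᴹ-∈-^ {X} n x∈X)))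

module Completion {c ℓ} (A : CommLBimonoid c ℓ) where
  open LBimonoidOrder A

  pairMonoid : CommutativeMonoid c ℓ
  pairMonoid = DirectProduct.commutativeMonoid ·-commutativeMonoid +-commutativeMonoid

  Pole : Pred (Carrier × Carrier) ℓ
  Pole (g , d) = g ⊑ d

  Pole-resp-≈ : Pole Respects CommutativeMonoid._≈_ pairMonoid
  Pole-resp-≈ (g≈g′ , d≈d′) g⊑d = ⊑-trans (≈⇒⊑ (≈-sym g≈g′)) (⊑-trans g⊑d (≈⇒⊑ d≈d′))

  open PhaseSpace pairMonoid Pole Pole-resp-≈ public
  open CommutativeMonoid pairMonoid using (_∙_)
  open ≤-Reasoning poset

  ι : Carrier → Fact
  ι a = record { ⟦_⟧ = ｛ (1# , a) ｝ ^⊥ ; closed = ^⊥^⊥^⊥⊆^⊥ }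

  ∈ι : ∀ {a g d} → g ⊑ d + a → (g , d) ∈ ⟦ ι a ⟧
  ∈ι g⊑d+a refl = ⊑-trans (≈⇒⊑ (·-identityʳ _)) g⊑d+a

  ∈ι⁻¹ : ∀ {a g d} → (g , d) ∈ ⟦ ι a ⟧ → g ⊑ d + a
  ∈ι⁻¹ g,d∈ιa = ⊑-trans (≈⇒⊑ (≈-sym (·-identityʳ _))) (g,d∈ιa refl)

  a,0∈ι : ∀ a → (a , 0#) ∈ ⟦ ι a ⟧
  a,0∈ι a = ∈ι (≈⇒⊑ (≈-sym (+-identityˡ a)))

  1,a∈~ι : ∀ a → (1# , a) ∈ ⟦ ~ ι a ⟧
  1,a∈~ι a = ^⊥-⊆-~ (ι a) (⊆-^⊥^⊥ refl)

  ⊥-a,0⇒⊑ : ∀ {a g d} → Pole ((g , d) ∙ (a , 0#)) → a · g ⊑ d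
  ⊥-a,0⇒⊑ {a} {g} {d} g·a⊑d+0 = begin
    a · g   ≈⟨ ·-comm a g ⟩
    g · a   ≤⟨ g·a⊑d+0 ⟩
    d + 0#  ≈⟨ +-identityʳ d ⟩
    d       ∎

  ι-mono : ∀ {a b} → a ⊑ b → ι a ≼ ι b
  ι-mono a⊑b g,d∈ιa = ∈ι (⊑-trans (∈ι⁻¹ g,d∈ιa) (+-monoʳ _ a⊑b))

  ι-least : ∀ {a} (Z : Fact) → (a , 0#) ∈ ⟦ Z ⟧ → ι a ≼ Z
  ι-least Z a,0∈Z g,d∈ιa = closed Z λ w∈Z^⊥ → cut (⊥-a,0⇒⊑ (w∈Z^⊥ a,0∈Z)) (∈ι⁻¹ g,d∈ιa)

  ι-injective : ∀ {a b} → ι a ≃ ι b → a ≈ b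
  ι-injective ιa≃ιb = ⊑-antisym (a,0∈ι⇒⊑ (to ιa≃ιb (a,0∈ι _))) (a,0∈ι⇒⊑ (from ιa≃ιb (a,0∈ι _)))
    where
    a,0∈ι⇒⊑ : ∀ {a b} → (a , 0#) ∈ ⟦ ι b ⟧ → a ⊑ b
    a,0∈ι⇒⊑ {a} {b} a,0∈ιb = ⊑-trans (∈ι⁻¹ a,0∈ιb) (≈⇒⊑ (+-identityˡ b))

  ι-∨ : ∀ a b → ι (a ∨ b) ≃ ι a ⊕ ι b
  ι-∨ a b = ≼-antisym
    (ι-least (ι a ⊕ ι b) λ {w} w⊥ → begin
      (a ∨ b) · proj₁ w            ≈⟨ ·-distribʳ-∨ (proj₁ w) a b ⟩
      a · proj₁ w ∨ b · proj₁ w    ≤⟨ ∨-least (⊥-a,0⇒⊑ (w⊥ (inj₁ (a,0∈ι a))))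
                                              (⊥-a,0⇒⊑ (w⊥ (inj₂ (a,0∈ι b)))) ⟩
      proj₂ w                      ≈⟨ +-identityˡ (proj₂ w) ⟨
      0# + proj₂ w                 ∎)
    (closure-least (ι (a ∨ b)) [ ι-mono (x≤x∨y a b) , ι-mono (y≤x∨y a b) ])

  ι-∧ : ∀ a b → ι (a ∧ b) ≃ ι a & ι b
  ι-∧ a b = ≼-antisym
    (λ g,d∈ → ι-mono (x∧y≤x a b) g,d∈ , ι-mono (x∧y≤y a b) g,d∈)
    (λ (g,d∈ιa , g,d∈ιb) → ∈ι (⊑-trans (∧-greatest (∈ι⁻¹ g,d∈ιa) (∈ι⁻¹ g,d∈ιb))
                                         (≈⇒⊑ (≈-sym (+-distrib-∧ _ a b)))))

  ι-⊗ : ∀ a b → ι (a · b) ≃ ι a ⊗ ι b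
  ι-⊗ a b = ≼-antisym
    (ι-least (ι a ⊗ ι b) (∈-resp-≈ (ι a ⊗ ι b) (≈-refl , +-identityˡ 0#)
                                   (∙-∈-⊗ {ι a} {ι b} (a,0∈ι a) (a,0∈ι b))))
    (⊗-least {ι a} {ι b} (ι (a · b)) λ x∈ιa y∈ιb →
      ∈ι (⊑-trans (·-mono (∈ι⁻¹ x∈ιa) (∈ι⁻¹ y∈ιb)) ([x+y]·[z+w]⊑[x+z]+y·w _ a _ b)))

  ι-𝟏 : ι 1# ≃ 𝟏
  ι-𝟏 = ≼-antisym (ι-least 𝟏 (⊆-^⊥^⊥ refl)) (closure-least (ι 1#) λ { refl → a,0∈ι 1# })

  ι-𝟎 : ι 0# ≃ 𝟎
  ι-𝟎 = ≼-antisym (λ x∈ → x∈) (λ x∈ → x∈)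

  ι-⅋ : ∀ a b → ι (a + b) ≃ ~ (~ ι a ⊗ ~ ι b)
  ι-⅋ a b = ≼-antisym
    (ι-least (~ (~ ι a ⊗ ~ ι b)) λ p∈ →
      ∈-resp-≈ 𝟎 (CommutativeMonoid.comm pairMonoid _ _)
               (⊗-least {~ ι a} {~ ι b} (𝟎 / (a + b , 0#)) (λ x∈ y∈ → ⊥⇒∈𝟎 (⊥-a+b,0 x∈ y∈)) p∈))
    (λ {(g , d)} g,d∈ → ∈ι (begin
      g               ≈⟨ ≈-trans (·-congˡ (·-identityˡ 1#)) (·-identityʳ g) ⟨
      g · (1# · 1#)   ≤⟨ ∈𝟎⇒⊥ (g,d∈ (∙-∈-⊗ {~ ι a} {~ ι b} (1,a∈~ι a) (1,a∈~ι b))) ⟩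
      d + (a + b)     ∎))
    where
    ⊥-a+b,0 : ∀ {x y} → x ∈ ⟦ ~ ι a ⟧ → y ∈ ⟦ ~ ι b ⟧ → Pole ((x ∙ y) ∙ (a + b , 0#))
    ⊥-a+b,0 {g , d} {g′ , d′} x∈ y∈ = begin
      (g · g′) · (a + b)  ≈⟨ ·-comm (g · g′) (a + b) ⟩
      (a + b) · (g · g′)  ≤⟨ [x+y]·[z·w]⊑x·z+y·w a b g g′ ⟩
      a · g + b · g′      ≤⟨ ⊑-trans (+-monoˡ _ (⊥-a,0⇒⊑ (~-⊆-^⊥ (ι a) x∈ (a,0∈ι a))))
                                     (+-monoʳ _ (⊥-a,0⇒⊑ (~-⊆-^⊥ (ι b) y∈ (a,0∈ι b)))) ⟩
      d + d′              ≈⟨ +-identityʳ (d + d′) ⟨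
      (d + d′) + 0#       ∎

  embedding : Embedding A phaseAlgebra
  embedding = record
    { f      = ι
    ; f-cong = λ a≈b → ≼-antisym (ι-mono (≈⇒⊑ a≈b)) (ι-mono (≈⇒⊑ (≈-sym a≈b)))
    ; f-inj  = ι-injective
    ; f-∨    = ι-∨
    ; f-∧    = ι-∧
    ; f-·    = ι-⊗
    ; f-1    = ι-𝟏
    ; f-+    = ι-⅋
    ; f-0    = ι-𝟎
    }

  ×ᴹ-pair : ∀ n g d → n ×ᴹ (g , d) ≡ (g ^ n , n ×̇ d)
  ×ᴹ-pair zero     g d = refl
  ×ᴹ-pair (sucℕ n) g d = cong ((g , d) ∙_) (×ᴹ-pair n g d)

  phaseAlgebra-sat : ∀ N → Bimonoid-Sat N A → CIRL-Sat N phaseAlgebra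
  phaseAlgebra-sat N A-sat n n∈N X = x≼y⇒x&y≃x {X} {CIRL._^_ phaseAlgebra X n} (≼-^ n shrink X)
    where
    shrink : ∀ {x y} → Pole (y ∙ (n ×ᴹ x)) → Pole (y ∙ x)
    shrink {g , d} {h , e} ⊥y∙xⁿ = begin
      h · g      ≤⟨ ·-monoʳ h (≤⇒⊑ (proj₁ (A-sat n n∈N g))) ⟩
      h · g ^ n  ≤⟨ subst (λ xⁿ → Pole ((h , e) ∙ xⁿ)) (×ᴹ-pair n g d) ⊥y∙xⁿ ⟩
      e + n ×̇ d  ≤⟨ +-monoʳ e (≤⇒⊑ (proj₂ (A-sat n n∈N d))) ⟩
      e + d      ∎

mainTheorem18 : ∀ {c ℓ c₂ ℓ₂} (N : Pred ℕ Level.zero) → (∀ n → n ∈ N → 1 ≤ n)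
    → (A : CommLBimonoid c ℓ)
    → (IsSubreduct c₂ ℓ₂ N A → Bimonoid-Sat N A)
      × (Bimonoid-Sat N A → IsSubreduct (suc (c ⊔ ℓ)) (suc (c ⊔ ℓ)) N A)
mainTheorem18 N _ A =
    (λ (B , B-sat , E) → EmbeddingReflects.Bimonoid-Sat-reflected E N B-sat)
  , (λ A-sat → phaseAlgebra , phaseAlgebra-sat N A-sat , embedding)
  where open Completion A
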